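{- Let $A$ be a DLCMI and $a,b\in A$. Then $(a,b)\in R(a,b)$ and $R(a,b)$ is a congruence of the lattice reduct $(A,\wedge,\vee)$ of $A$.
   Context: A DLCMI is an algebra $(A,\wedge,\vee,\cdot,\to,1)$ of type $(2,2,2,2,0)$ such that for all $a,b,c\in A$: (1) $(A,\wedge,\vee)$ is a distributive lattice; (2) $1$ is the largest element; (3) $(A,\cdot,1)$ is a commutative monoid; (4) $(a\to b)\wedge(a\to c)=a\to(b\wedge c)$; (5) $(a\to c)\wedge(b\to c)=(a\vee b)\to c$; (6) $a\to a=1$; (7) $(a\vee b)\cdot c=(a\cdot c)\vee(b\cdot c)$; (8) $(a\to b)\cdot(b\to c)\le a\to c$; (9) $a\to b\le (a\cdot c)\to(b\cdot c)$. Notation: $x^0=1$, $x^{n}=x\cdot x^{n-1}$; $\Box(x)=1\to x$, $\Box^0(x)=x$, $\Box^{n+1}(x)=\Box(\Box^n(x))$; $x\leftrightarrow y=(x\to y)\wedge(y\to x)$; $t_n(a,b)=\Box^0(a\leftrightarrow b)\wedge\Box(a\leftrightarrow b)\wedge\cdots\wedge\Box^n(a\leftrightarrow b)$ for $n\ge 0$; $t_n^k(a,b)=(t_n(a,b))^k$. The relation $R(a,b)$ on $A$: $(c,d)\in R(a,b)$ iff there are natural numbers $n,k$ such that (C1) $t_n^k(a,b)\cdot(c\wedge a\wedge b)\le d\wedge a\wedge b$ and $t_n^k(a,b)\cdot(d\wedge a\wedge b)\le c\wedge a\wedge b$; (C2) $t_n^k(a,b)\cdot(c\vee a\vee b)\le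 d\vee a\vee b$ and $t_n^k(a,b)\cdot(d\vee a\vee b)\le c\vee a\vee b$; (C3) $t_n^k(a,b)\le c\leftrightarrow d$. -}

module Defs where

open import Level using (Level; suc; _⊔_)
open import Data.Nat using (ℕ; zero) renaming (suc to sucℕ)
open import Data.Product using (_×_; ∃-syntax)
open import Relation.Binary.PropositionalEquality using (_≡_)
open import Relation.Binary.Core using (Rel; _Preserves₂_⟶_⟶_)
open import Relation.Binary.Structures using (IsEquivalence)
open import Algebra.Lattice.Structures using (IsDistributiveLattice)

record DLCMI (c : Level) : Set (suc c) where
  infixr 6 _∨_
  infixr 7 _∧_
  infixl 8 _·_
  infixr 5 _⇒_
  field
    Carrier : Set c
    _∧_ _∨_ _·_ _⇒_ : Carrier → Carrier → Carrier
    𝟏 : Carrier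
    isDistributiveLattice : IsDistributiveLattice _≡_ _∨_ _∧_

  infix 4 _≤_
  _≤_ : Carrier → Carrier → Set c
  a ≤ b = a ∧ b ≡ a

  field
    top : ∀ a → a ≤ 𝟏
    ·-assoc : ∀ a b c → (a · b) · c ≡ a · (b · c)
    ·-comm : ∀ a b → a · b ≡ b · a
    ·-identityˡ : ∀ a → 𝟏 · a ≡ a
    ax4 : ∀ a b c → (a ⇒ b) ∧ (a ⇒ c) ≡ a ⇒ (b ∧ c)
    ax5 : ∀ a b c → (a ⇒ c) ∧ (b ⇒ c) ≡ (a ∨ b) ⇒ c
    ax6 : ∀ a → a ⇒ a ≡ 𝟏
    ax7 : ∀ a b c → (a ∨ b) · c ≡ (a · c) ∨ (b · c)
    ax8 : ∀ a b c → (a ⇒ b) · (b ⇒ c) ≤ (a ⇒ c)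
    ax9 : ∀ a b c → (a ⇒ b) ≤ ((a · c) ⇒ (b · c))

module DLCMINotation {c : Level} (A : DLCMI c) where
  open DLCMI A

  _^_ : Carrier → ℕ → Carrier
  x ^ zero = 𝟏
  x ^ sucℕ n = x · (x ^ n)

  □ : Carrier → Carrier
  □ x = 𝟏 ⇒ x

  □^ : ℕ → Carrier → Carrier
  □^ zero x = x
  □^ (sucℕ n) x = □ (□^ n x)

  infixr 5 _⇔_
  _⇔_ : Carrier → Carrier → Carrier
  x ⇔ y = (x ⇒ y) ∧ (y ⇒ x)

  t : ℕ → Carrier → Carrier → Carrier
  t zero a b = □^ zero (a ⇔ b)
  t (sucℕ n) a b = t n a b ∧ □^ (sucℕ n) (a ⇔ b)

  tk : ℕ → ℕ → Carrier → Carrier → Carrier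
  tk n k a b = t n a b ^ k

  R : Carrier → Carrier → Rel Carrier c
  R a b x y = ∃[ n ] ∃[ k ]
      ( (tk n k a b · (x ∧ a ∧ b) ≤ (y ∧ a ∧ b)
         × tk n k a b · (y ∧ a ∧ b) ≤ (x ∧ a ∧ b))
      × (tk n k a b · (x ∨ a ∨ b) ≤ (y ∨ a ∨ b)
         × tk n k a b · (y ∨ a ∨ b) ≤ (x ∨ a ∨ b))
      × tk n k a b ≤ (x ⇔ y) )

  record IsLatticeCongruence (θ : Rel Carrier c) : Set c where
    field
      isEquivalence : IsEquivalence θ
      ∧-cong : _∧_ Preserves₂ θ ⟶ θ ⟶ θ
      ∨-cong : _∨_ Preserves₂ θ ⟶ θ ⟶ θ

-- Each clause of R(a,b) has the shape s · f x ≤ f y (with f = _∧ (a ∧ b) or f = _∨ (a ∨ b))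
-- or s ≤ x ⇔ y, for the element s = t_n^k(a,b). Clauses of this shape compose by
-- multiplying the elements s, because the product is monotone and (x ⇔ y)·(y ⇔ z) ≤ x ⇔ z;
-- they are preserved by meeting or joining both sides with a fixed element, because both
-- choices of f are lattice endomorphisms of a distributive lattice, the product is integral
-- (s · x ≤ x) and ⇔ is compatible with ∧ and ∨. Finally t_{m+n}^{k+l} ≤ t_m^k · t_n^l,
-- since the sequence t_n decreases, so R(a,b) is closed under composition.
module Submission where

open import Level using (Level)
open import Data.Nat.Base as ℕ using (zero; suc)
open import Data.Nat.Properties using (+-comm)
open import Data.Product.Base using (_×_; _,_)
open import Function.Base using (_∘_)
open import Relation.Binary.PropositionalEquality
  using (_≡_; sym; trans; cong; cong₂; subst; subst₂; isEquivalence)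
open import Relation.Binary.Lattice using (Lattice)
import Relation.Binary.Lattice.Properties.MeetSemilattice as MeetSemilatticeProperties
import Relation.Binary.Lattice.Properties.JoinSemilattice as JoinSemilatticeProperties
import Relation.Binary.Reasoning.PartialOrder as PartialOrderReasoning
open import Algebra.Lattice.Bundles using (DistributiveLattice)
import Algebra.Lattice.Properties.Lattice as LatticeProperties
open import Algebra.Lattice.Structures using (IsDistributiveLattice)
import Algebra.Morphism.Definitions as MorphismDefinitions
open import Defs

module DLCMIProperties {c : Level} (A : DLCMI c) where
  open DLCMI A
  open DLCMINotation A
  open IsDistributiveLattice isDistributiveLattice
    using (∧-comm; ∨-comm; ∧-distribʳ-∨; ∨-distribʳ-∧)
  open MorphismDefinitions Carrier Carrier _≡_ using (Homomorphic₂)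

  distributiveLattice : DistributiveLattice c c
  distributiveLattice = record
    { Carrier = Carrier ; _≈_ = _≡_ ; _∨_ = _∨_ ; _∧_ = _∧_
    ; isDistributiveLattice = isDistributiveLattice
    }

  -- The library orders a lattice by x ≡ x ∧ y; the DLCMI order is x ∧ y ≡ x, so the
  -- order-theoretic structure is transported along sym.
  orderLattice : Lattice c c c
  orderLattice = record
    { Carrier = Carrier ; _≈_ = _≡_ ; _≤_ = _≤_ ; _∨_ = _∨_ ; _∧_ = _∧_
    ; isLattice = record
      { isPartialOrder = record
        { isPreorder = record
          { isEquivalence = isEquivalence
          ; reflexive = sym ∘ L.reflexive
          ; trans = λ p q → sym (L.trans (sym p) (sym q))
          }
        ; antisym = λ p q → L.antisym (sym p) (sym q)
        }
      ; supremum = λ x y → let x≤ , y≤ , least = L.supremum x y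
                           in sym x≤ , sym y≤ , λ z p q → sym (least z (sym p) (sym q))
      ; infimum = λ x y → let ≤x , ≤y , greatest = L.infimum x y
                          in sym ≤x , sym ≤y , λ z p q → sym (greatest z (sym p) (sym q))
      }
    }
    where
    module L = Lattice (LatticeProperties.∨-∧-orderTheoreticLattice
                          (DistributiveLattice.lattice distributiveLattice))

  open Lattice orderLattice
    using (x∧y≤x; x∧y≤y; ∧-greatest; x≤x∨y; y≤x∨y; ∨-least)
    renaming (refl to ≤-refl; reflexive to ≤-reflexive; trans to ≤-trans; antisym to ≤-antisym)
  open MeetSemilatticeProperties (Lattice.meetSemilattice orderLattice)
    using (∧-monotonic; y≤x⇒x∧y≈y)
  open JoinSemilatticeProperties (Lattice.joinSemilattice orderLattice)
    using (∨-monotonic; x≤y⇒x∨y≈y)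
  open PartialOrderReasoning (Lattice.poset orderLattice)

  ∧-homo⇒mono : ∀ {f} → Homomorphic₂ f _∧_ _∧_ → ∀ {x y} → x ≤ y → f x ≤ f y
  ∧-homo⇒mono {f} homo {x} {y} x≤y = trans (sym (homo x y)) (cong f x≤y)

  ∧ʳ-homo-∧ : ∀ d → Homomorphic₂ (_∧ d) _∧_ _∧_
  ∧ʳ-homo-∧ d x y = ≤-antisym
    (∧-greatest (∧-monotonic (x∧y≤x x y) ≤-refl) (∧-monotonic (x∧y≤y x y) ≤-refl))
    (∧-greatest (∧-monotonic (x∧y≤x x d) (x∧y≤x y d)) (≤-trans (x∧y≤y _ _) (x∧y≤y y d)))

  ∧ʳ-homo-∨ : ∀ d → Homomorphic₂ (_∧ d) _∨_ _∨_
  ∧ʳ-homo-∨ = ∧-distribʳ-∨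

  ∨ʳ-homo-∧ : ∀ e → Homomorphic₂ (_∨ e) _∧_ _∧_
  ∨ʳ-homo-∧ = ∨-distribʳ-∧

  ∨ʳ-homo-∨ : ∀ e → Homomorphic₂ (_∨ e) _∨_ _∨_
  ∨ʳ-homo-∨ e x y = ≤-antisym
    (∨-least (∨-monotonic (x≤x∨y x e) (x≤x∨y y e)) (≤-trans (y≤x∨y y e) (y≤x∨y _ _)))
    (∨-least (∨-monotonic (x≤x∨y x y) ≤-refl) (∨-monotonic (y≤x∨y x y) ≤-refl))

  ·-identityʳ : ∀ x → x · 𝟏 ≡ x
  ·-identityʳ x = trans (·-comm x 𝟏) (·-identityˡ x)

  ·-distribˡ-∨ : ∀ s x y → s · (x ∨ y) ≡ s · x ∨ s · y
  ·-distribˡ-∨ s x y = trans (·-comm s _) (trans (ax7 x y s) (cong₂ _∨_ (·-comm x s) (·-comm y s)))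

  ·-monoˡ : ∀ {x y} z → x ≤ y → x · z ≤ y · z
  ·-monoˡ {x} {y} z x≤y = begin
    x · z          ≤⟨ x≤x∨y _ _ ⟩
    x · z ∨ y · z  ≡⟨ ax7 x y z ⟨
    (x ∨ y) · z    ≡⟨ cong (_· z) (x≤y⇒x∨y≈y x≤y) ⟩
    y · z          ∎

  ·-monoʳ : ∀ {x y} z → x ≤ y → z · x ≤ z · y
  ·-monoʳ {x} {y} z x≤y = subst₂ _≤_ (·-comm x z) (·-comm y z) (·-monoˡ z x≤y)

  ·-mono : ∀ {x y u v} → x ≤ y → u ≤ v → x · u ≤ y · v
  ·-mono x≤y u≤v = ≤-trans (·-monoˡ _ x≤y) (·-monoʳ _ u≤v)

  x·y≤y : ∀ x y → x · y ≤ y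
  x·y≤y x y = subst (x · y ≤_) (·-identityˡ y) (·-monoˡ y (top x))

  ^-homo-+ : ∀ s m n → s ^ (m ℕ.+ n) ≡ s ^ m · s ^ n
  ^-homo-+ s zero    n = sym (·-identityˡ _)
  ^-homo-+ s (suc m) n = trans (cong (s ·_) (^-homo-+ s m n)) (sym (·-assoc s _ _))

  ^-monoˡ : ∀ {x y} n → x ≤ y → x ^ n ≤ y ^ n
  ^-monoˡ zero    x≤y = ≤-refl
  ^-monoˡ (suc n) x≤y = ·-mono x≤y (^-monoˡ n x≤y)

  ⇒-monoʳ : ∀ {x y z} → y ≤ z → x ⇒ y ≤ x ⇒ z
  ⇒-monoʳ {x} {y} {z} y≤z = begin
    x ⇒ y              ≡⟨ cong (x ⇒_) y≤z ⟨
    x ⇒ (y ∧ z)        ≡⟨ ax4 x y z ⟨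
    (x ⇒ y) ∧ (x ⇒ z)  ≤⟨ x∧y≤y _ _ ⟩
    x ⇒ z              ∎

  ⇒-antitoneˡ : ∀ {x y z} → x ≤ y → y ⇒ z ≤ x ⇒ z
  ⇒-antitoneˡ {x} {y} {z} x≤y = begin
    y ⇒ z              ≡⟨ cong (_⇒ z) (x≤y⇒x∨y≈y x≤y) ⟨
    (x ∨ y) ⇒ z        ≡⟨ ax5 x y z ⟨
    (x ⇒ z) ∧ (y ⇒ z)  ≤⟨ x∧y≤x _ _ ⟩
    x ⇒ z              ∎

  ⇒-top : ∀ {x y} z → x ≤ y → z ≤ x ⇒ y
  ⇒-top {x} {y} z x≤y = begin
    z      ≤⟨ top z ⟩
    𝟏      ≡⟨ ax6 x ⟨
    x ⇒ x  ≤⟨ ⇒-monoʳ x≤y ⟩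
    x ⇒ y  ∎

  ⇔-trans : ∀ x y z → (x ⇔ y) · (y ⇔ z) ≤ x ⇔ z
  ⇔-trans x y z = ∧-greatest
    (≤-trans (·-mono (x∧y≤x _ _) (x∧y≤x _ _)) (ax8 x y z))
    (≤-trans (≤-reflexive (·-comm _ _)) (≤-trans (·-mono (x∧y≤y _ _) (x∧y≤y _ _)) (ax8 z y x)))

  ⇔-∧-compat : ∀ x y u → x ⇔ y ≤ (x ∧ u) ⇔ (y ∧ u)
  ⇔-∧-compat x y u = ∧-monotonic (⇒-∧-compat x y) (⇒-∧-compat y x)
    where
    ⇒-∧-compat : ∀ x y → x ⇒ y ≤ (x ∧ u) ⇒ (y ∧ u)
    ⇒-∧-compat x y = begin
      x ⇒ y                          ≤⟨ ∧-greatest (⇒-antitoneˡ (x∧y≤x x u)) (⇒-top _ (x∧y≤y x u)) ⟩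
      ((x ∧ u) ⇒ y) ∧ ((x ∧ u) ⇒ u)  ≡⟨ ax4 (x ∧ u) y u ⟩
      (x ∧ u) ⇒ (y ∧ u)              ∎

  ⇔-∨-compat : ∀ x y u → x ⇔ y ≤ (x ∨ u) ⇔ (y ∨ u)
  ⇔-∨-compat x y u = ∧-monotonic (⇒-∨-compat x y) (⇒-∨-compat y x)
    where
    ⇒-∨-compat : ∀ x y → x ⇒ y ≤ (x ∨ u) ⇒ (y ∨ u)
    ⇒-∨-compat x y = begin
      x ⇒ y                          ≤⟨ ∧-greatest (⇒-monoʳ (x≤x∨y y u)) (⇒-top _ (y≤x∨y y u)) ⟩
      (x ⇒ (y ∨ u)) ∧ (u ⇒ (y ∨ u))  ≡⟨ ax5 x u (y ∨ u) ⟩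
      (x ∨ u) ⇒ (y ∨ u)              ∎

  Linked : Carrier → (Carrier → Carrier) → Carrier → Carrier → Set c
  Linked s f x y = s · f x ≤ f y × s · f y ≤ f x

  module _ (f : Carrier → Carrier) where

    Linked-refl : ∀ {x} → Linked 𝟏 f x x
    Linked-refl = ≤-reflexive (·-identityˡ _) , ≤-reflexive (·-identityˡ _)

    Linked-sym : ∀ {s x y} → Linked s f x y → Linked s f y x
    Linked-sym (p , q) = q , p

    Linked-trans : ∀ {s s′ x y z} →
                   Linked s f x y → Linked s′ f y z → Linked (s · s′) f x z
    Linked-trans {s} {s′} (p , p′) (q , q′) =
      ≤-trans (≤-reflexive (cong (_· _) (·-comm s s′))) (chain p q) , chain q′ p′
      where
      chain : ∀ {s s′ x y z} → s′ · x ≤ y → s · y ≤ z → (s · s′) · x ≤ z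
      chain {s} s′x≤y sy≤z = ≤-trans (≤-reflexive (·-assoc _ _ _)) (≤-trans (·-monoʳ s s′x≤y) sy≤z)

    Linked-anti : ∀ {s s′ x y} → s ≤ s′ → Linked s′ f x y → Linked s f x y
    Linked-anti s≤s′ (p , q) = ≤-trans (·-monoˡ _ s≤s′) p , ≤-trans (·-monoˡ _ s≤s′) q

    Linked-≡ : ∀ {s x y} → f x ≡ f y → Linked s f x y
    Linked-≡ {s} fx≡fy =
      ≤-trans (x·y≤y s _) (≤-reflexive fx≡fy) , ≤-trans (x·y≤y s _) (≤-reflexive (sym fx≡fy))

    Linked-∧ʳ : Homomorphic₂ f _∧_ _∧_ →
                ∀ {s x y u} → Linked s f x y → Linked s f (x ∧ u) (y ∧ u)
    Linked-∧ʳ homo {s} {u = u} (p , q) = shift p , shift q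
      where
      shift : ∀ {x y} → s · f x ≤ f y → s · f (x ∧ u) ≤ f (y ∧ u)
      shift {x} {y} p = begin
        s · f (x ∧ u)  ≤⟨ ∧-greatest (≤-trans (·-monoʳ s (∧-homo⇒mono homo (x∧y≤x x u))) p)
                                     (≤-trans (x·y≤y s _) (∧-homo⇒mono homo (x∧y≤y x u))) ⟩
        f y ∧ f u      ≡⟨ homo y u ⟨
        f (y ∧ u)      ∎

    Linked-∨ʳ : Homomorphic₂ f _∨_ _∨_ →
                ∀ {s x y u} → Linked s f x y → Linked s f (x ∨ u) (y ∨ u)
    Linked-∨ʳ homo {s} {u = u} (p , q) = shift p , shift q
      where
      shift : ∀ {x y} → s · f x ≤ f y → s · f (x ∨ u) ≤ f (y ∨ u)
      shift {x} {y} p = begin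
        s · f (x ∨ u)      ≡⟨ cong (s ·_) (homo x u) ⟩
        s · (f x ∨ f u)    ≡⟨ ·-distribˡ-∨ s _ _ ⟩
        s · f x ∨ s · f u  ≤⟨ ∨-monotonic p (x·y≤y s _) ⟩
        f y ∨ f u          ≡⟨ homo y u ⟨
        f (y ∨ u)          ∎

  module _ (d e : Carrier) where

    Witness : Carrier → Carrier → Carrier → Set c
    Witness s x y = Linked s (_∧ d) x y × Linked s (_∨ e) x y × s ≤ x ⇔ y

    Witness-refl : ∀ {x} → Witness 𝟏 x x
    Witness-refl =
      Linked-refl (_∧ d) , Linked-refl (_∨ e) , ∧-greatest (⇒-top 𝟏 ≤-refl) (⇒-top 𝟏 ≤-refl)

    Witness-sym : ∀ {s x y} → Witness s x y → Witness s y x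
    Witness-sym (p , q , r) = Linked-sym (_∧ d) p , Linked-sym (_∨ e) q , subst (_ ≤_) (∧-comm _ _) r

    Witness-trans : ∀ {s s′ x y z} → Witness s x y → Witness s′ y z → Witness (s · s′) x z
    Witness-trans (p , q , r) (p′ , q′ , r′) =
      Linked-trans (_∧ d) p p′ , Linked-trans (_∨ e) q q′ , ≤-trans (·-mono r r′) (⇔-trans _ _ _)

    Witness-anti : ∀ {s s′ x y} → s ≤ s′ → Witness s′ x y → Witness s x y
    Witness-anti s≤s′ (p , q , r) =
      Linked-anti (_∧ d) s≤s′ p , Linked-anti (_∨ e) s≤s′ q , ≤-trans s≤s′ r

    Witness-∧ʳ : ∀ {s x y u} → Witness s x y → Witness s (x ∧ u) (y ∧ u)
    Witness-∧ʳ (p , q , r) =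
      Linked-∧ʳ (_∧ d) (∧ʳ-homo-∧ d) p ,
      Linked-∧ʳ (_∨ e) (∨ʳ-homo-∧ e) q ,
      ≤-trans r (⇔-∧-compat _ _ _)

    Witness-∨ʳ : ∀ {s x y u} → Witness s x y → Witness s (x ∨ u) (y ∨ u)
    Witness-∨ʳ (p , q , r) =
      Linked-∨ʳ (_∧ d) (∧ʳ-homo-∨ d) p ,
      Linked-∨ʳ (_∨ e) (∨ʳ-homo-∨ e) q ,
      ≤-trans r (⇔-∨-compat _ _ _)

  module _ (a b : Carrier) where

    t-+-≤ʳ : ∀ m n → t (m ℕ.+ n) a b ≤ t n a b
    t-+-≤ʳ zero    n = ≤-refl
    t-+-≤ʳ (suc m) n = ≤-trans (x∧y≤x _ _) (t-+-≤ʳ m n)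

    t-+-≤ˡ : ∀ m n → t (m ℕ.+ n) a b ≤ t m a b
    t-+-≤ˡ m n = subst (λ i → t i a b ≤ t m a b) (+-comm n m) (t-+-≤ʳ n m)

    tk-+ : ∀ m n k l → tk (m ℕ.+ n) (k ℕ.+ l) a b ≤ tk m k a b · tk n l a b
    tk-+ m n k l = begin
      t (m ℕ.+ n) a b ^ (k ℕ.+ l)                ≡⟨ ^-homo-+ _ k l ⟩
      t (m ℕ.+ n) a b ^ k · t (m ℕ.+ n) a b ^ l  ≤⟨ ·-mono (^-monoˡ k (t-+-≤ˡ m n))
                                                           (^-monoˡ l (t-+-≤ʳ m n)) ⟩
      t m a b ^ k · t n a b ^ l                  ∎

    R-refl : ∀ {x} → R a b x x
    R-refl = 0 , 0 , Witness-refl _ _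

    R-sym : ∀ {x y} → R a b x y → R a b y x
    R-sym (n , k , w) = n , k , Witness-sym _ _ w

    R-trans : ∀ {x y z} → R a b x y → R a b y z → R a b x z
    R-trans (m , k , v) (n , l , w) =
      m ℕ.+ n , k ℕ.+ l , Witness-anti _ _ (tk-+ m n k l) (Witness-trans _ _ v w)

    R-∧ʳ : ∀ {x y u} → R a b x y → R a b (x ∧ u) (y ∧ u)
    R-∧ʳ (n , k , w) = n , k , Witness-∧ʳ _ _ w

    R-∨ʳ : ∀ {x y u} → R a b x y → R a b (x ∨ u) (y ∨ u)
    R-∨ʳ (n , k , w) = n , k , Witness-∨ʳ _ _ w

    R-∧ : ∀ {x y u v} → R a b x y → R a b u v → R a b (x ∧ u) (y ∧ v)
    R-∧ {y = y} {u} {v} x~y u~v =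
      R-trans (R-∧ʳ x~y) (subst₂ (R a b) (∧-comm u y) (∧-comm v y) (R-∧ʳ u~v))

    R-∨ : ∀ {x y u v} → R a b x y → R a b u v → R a b (x ∨ u) (y ∨ v)
    R-∨ {y = y} {u} {v} x~y u~v =
      R-trans (R-∨ʳ x~y) (subst₂ (R a b) (∨-comm u y) (∨-comm v y) (R-∨ʳ u~v))

    R-isLatticeCongruence : IsLatticeCongruence (R a b)
    R-isLatticeCongruence = record
      { isEquivalence = record { refl = R-refl ; sym = R-sym ; trans = R-trans }
      ; ∧-cong = R-∧
      ; ∨-cong = R-∨
      }

    R-self : R a b a b
    R-self = 0 , 1 ,
      Linked-≡ (_∧ (a ∧ b)) (trans (y≤x⇒x∧y≈y (x∧y≤x a b)) (sym (y≤x⇒x∧y≈y (x∧y≤y a b)))) ,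
      Linked-≡ (_∨ (a ∨ b)) (trans (x≤y⇒x∨y≈y (x≤x∨y a b)) (sym (x≤y⇒x∨y≈y (y≤x∨y a b)))) ,
      ≤-reflexive (·-identityʳ _)

lemma3p6 : ∀ {c : Level} (A : DLCMI c) (a b : DLCMI.Carrier A) →
    DLCMINotation.R A a b a b × DLCMINotation.IsLatticeCongruence A (DLCMINotation.R A a b)
lemma3p6 A a b = R-self a b , R-isLatticeCongruence a b
  where open DLCMIProperties A
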